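{- Let $G$ be a graph on $n$ vertices with minimum degree $\delta(G) \geq 1$ and such that no two vertices of degree $1$ are adjacent. Then \[ |E(G)| \geq \left\lceil \frac{2n}{3}\right\rceil. \] -}

module Defs where

open import Data.Nat using (ℕ; zero; suc; _+_; _*_; _≤_)
open import Data.Nat.DivMod using (_/_)
open import Data.Bool using (Bool; true; false; if_then_else_)
open import Data.Fin using (Fin; _<_)
open import Data.List using (List; length; filter)
open import Data.List using (allFin; cartesianProduct)
open import Data.Product using (_×_; _,_; proj₁; proj₂)
open import Relation.Binary.PropositionalEquality using (_≡_)
open import Relation.Nullary using (¬_)
open import Data.Fin using (_<?_)
open import Relation.Nullary.Decidable using (does)

record Graph (n : ℕ) : Set where
  field
    adj      : Fin n → Fin n → Bool
    sym      : ∀ i j → adj i j ≡ adj j i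
    irrefl   : ∀ i → adj i i ≡ false

open Graph public

Adj : ∀ {n} → Graph n → Fin n → Fin n → Set
Adj G i j = adj G i j ≡ true

degree : ∀ {n} → Graph n → Fin n → ℕ
degree {n} G v = length (filter (λ w → adj G v w ≡? true) (allFin n))
  where
    open import Data.Bool.Properties using () renaming (_≟_ to _≡?_)

edges : ∀ {n} → Graph n → List (Fin n × Fin n)
edges {n} G = filter (λ p → dec p) (cartesianProduct (allFin n) (allFin n))
  where
    open import Data.Bool.Properties using () renaming (_≟_ to _≡?_)
    open import Relation.Nullary.Decidable using (_×-dec_)
    dec = λ (p : Fin n × Fin n) → (proj₁ p <? proj₂ p) ×-dec (adj G (proj₁ p) (proj₂ p) ≡? true)

numEdges : ∀ {n} → Graph n → ℕ
numEdges G = length (edges G)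

-- ⌈ 2n / 3 ⌉ computed as ⌊ (2n + 2) / 3 ⌋.
ceil2n/3 : ℕ → ℕ
ceil2n/3 n = (2 * n + 2) / 3

-- Give every vertex the weight 2 if it is a leaf and 1 otherwise. Since
-- δ(G) ≥ 1, every vertex has weighted degree deg(v)·w(v) ≥ 2, so the weighted
-- degrees sum to at least 2n. Counted edge by edge, the same sum is
-- Σ_{uv ∈ E} (w(u) + w(v)), and since no two leaves are adjacent each edge
-- contributes at most 3. Hence 2n ≤ 3|E(G)|.
module Submission where

open import Defs
open import Data.Nat using (ℕ; zero; suc; _+_; _*_; _≤_; _≥_; z≤n; s≤s; s≤s⁻¹)
open import Data.Nat.Properties
  using ( +-*-semiring; +-comm; +-identityʳ; *-comm; *-identityʳ; *-distribˡ-+; *-distribʳ-+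
        ; +-mono-≤; +-monoˡ-≤; +-monoʳ-<; ≤-refl; ≤∧≢⇒<; module ≤-Reasoning)
  renaming (_≟_ to _≟ℕ_)
open import Data.Nat.DivMod using (m<n*o⇒m/o<n)
open import Data.Fin using (Fin; zero; suc; _<?_) renaming (_<_ to _<ᶠ_)
open import Data.Fin.Properties using (<-cmp)
open import Data.Bool using (true; false; if_then_else_)
open import Data.Bool.Properties using (_≟_)
open import Data.List using (List; length; map; filter; tabulate; cartesianProduct; _++_)
open import Data.List.Properties using (length-++; filter-++; map-tabulate)
open import Data.Product using (_×_; _,_; proj₁; proj₂)
open import Data.Empty using (⊥-elim)
open import Relation.Nullary using (¬_; Dec; yes; no; does)
open import Relation.Nullary.Decidable using (_×-dec_)
open import Relation.Unary using (Decidable)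
open import Relation.Binary.Definitions using (tri<; tri≈; tri>)
open import Relation.Binary.PropositionalEquality
  using (_≡_; refl; trans; cong; cong₂; module ≡-Reasoning) renaming (sym to ≡-sym)
open import Function using (id; _∘_)
open import Algebra.Properties.Semiring.Sum +-*-semiring
  using (sum; sum-syntax; sum-cong-≗; ∑-distrib-+; ∑-comm; *-distribʳ-sum)

indicator : ∀ {P : Set} → Dec P → ℕ
indicator d = if does d then 1 else 0

indicator-×-yes : ∀ {P Q : Set} (p? : Dec P) (q? : Dec Q) → P → indicator (p? ×-dec q?) ≡ indicator q?
indicator-×-yes (yes _) q? _ = refl
indicator-×-yes (no ¬p) q? p = ⊥-elim (¬p p)

indicator-×-no : ∀ {P Q : Set} (p? : Dec P) (q? : Dec Q) → ¬ P → indicator (p? ×-dec q?) ≡ 0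
indicator-×-no (yes p) q? ¬p = ⊥-elim (¬p p)
indicator-×-no (no _)  q? ¬p = refl

indicator-*-mono : ∀ {P : Set} (p? : Dec P) {x y} → (P → x ≤ y) → indicator p? * x ≤ indicator p? * y
indicator-*-mono (yes p) x≤y = +-monoˡ-≤ 0 (x≤y p)
indicator-*-mono (no _)  x≤y = z≤n

∑-const : ∀ n c → ∑[ i < n ] c ≡ n * c
∑-const zero    c = refl
∑-const (suc n) c = cong (c +_) (∑-const n c)

∑-mono-≤ : ∀ {n} {f g : Fin n → ℕ} → (∀ i → f i ≤ g i) → sum f ≤ sum g
∑-mono-≤ {zero}  f≤g = z≤n
∑-mono-≤ {suc n} f≤g = +-mono-≤ (f≤g zero) (∑-mono-≤ (f≤g ∘ suc))

∑∑-distrib-+ : ∀ {m n} (f g : Fin m → Fin n → ℕ) →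
  ∑[ i < m ] ∑[ j < n ] (f i j + g i j) ≡ ∑[ i < m ] ∑[ j < n ] f i j + ∑[ i < m ] ∑[ j < n ] g i j
∑∑-distrib-+ {n = n} f g =
  trans (sum-cong-≗ (λ i → ∑-distrib-+ (f i) (g i))) (∑-distrib-+ (λ i → ∑[ j < n ] f i j) (λ i → ∑[ j < n ] g i j))

∑∑-distribʳ-* : ∀ {m n} (f : Fin m → Fin n → ℕ) c →
  ∑[ i < m ] ∑[ j < n ] (f i j * c) ≡ (∑[ i < m ] ∑[ j < n ] f i j) * c
∑∑-distribʳ-* {n = n} f c =
  ≡-sym (trans (*-distribʳ-sum c (λ i → ∑[ j < n ] f i j)) (sum-cong-≗ (λ i → *-distribʳ-sum c (f i))))

module _ {A : Set} {P : A → Set} (P? : Decidable P) where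

  length-filter-++ : ∀ (xs ys : List A) → length (filter P? (xs ++ ys)) ≡ length (filter P? xs) + length (filter P? ys)
  length-filter-++ xs ys = trans (cong length (filter-++ P? xs ys)) (length-++ (filter P? xs))

  length-filter-tabulate : ∀ {n} (f : Fin n → A) → length (filter P? (tabulate f)) ≡ ∑[ i < n ] indicator (P? (f i))
  length-filter-tabulate {zero}  f = refl
  length-filter-tabulate {suc n} f with does (P? (f zero))
  ... | true  = cong suc (length-filter-tabulate (f ∘ suc))
  ... | false = length-filter-tabulate (f ∘ suc)

length-filter-cartesianProduct : ∀ {A B : Set} {P : A × B → Set} (P? : Decidable P) {m n} (f : Fin m → A) (g : Fin n → B) →
  length (filter P? (cartesianProduct (tabulate f) (tabulate g))) ≡ ∑[ i < m ] ∑[ j < n ] indicator (P? (f i , g j))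
length-filter-cartesianProduct P? {zero}  f g = refl
length-filter-cartesianProduct P? {suc m} {n} f g = begin
  length (filter P? (map (f zero ,_) (tabulate g) ++ cartesianProduct (tabulate (f ∘ suc)) (tabulate g)))
    ≡⟨ length-filter-++ P? (map (f zero ,_) (tabulate g)) _ ⟩
  length (filter P? (map (f zero ,_) (tabulate g))) + length (filter P? (cartesianProduct (tabulate (f ∘ suc)) (tabulate g)))
    ≡⟨ cong₂ _+_ (trans (cong (length ∘ filter P?) (map-tabulate g (f zero ,_))) (length-filter-tabulate P? ((f zero ,_) ∘ g)))
                 (length-filter-cartesianProduct P? (f ∘ suc) g) ⟩
  ∑[ i < suc m ] ∑[ j < n ] indicator (P? (f i , g j)) ∎
  where open ≡-Reasoning

module _ {n} (G : Graph n) where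

  adjacent? : ∀ i j → Dec (Adj G i j)
  adjacent? i j = adj G i j ≟ true

  edge? : ∀ i j → Dec (i <ᶠ j × Adj G i j)
  edge? i j = (i <? j) ×-dec adjacent? i j

  degree≡∑ : ∀ v → degree G v ≡ ∑[ j < n ] indicator (adjacent? v j)
  degree≡∑ v = length-filter-tabulate (adjacent? v) id

  numEdges≡∑∑ : numEdges G ≡ ∑[ i < n ] ∑[ j < n ] indicator (edge? i j)
  numEdges≡∑∑ = length-filter-cartesianProduct (λ p → edge? (proj₁ p) (proj₂ p)) id id

  indicator-adjacent-sym : ∀ i j → indicator (adjacent? i j) ≡ indicator (adjacent? j i)
  indicator-adjacent-sym i j = cong (λ b → indicator (b ≟ true)) (Graph.sym G i j)

  indicator-adjacent-irrefl : ∀ i → indicator (adjacent? i i) ≡ 0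
  indicator-adjacent-irrefl i = cong (λ b → indicator (b ≟ true)) (irrefl G i)

  adjacent≡edge+edge : ∀ i j → indicator (adjacent? i j) ≡ indicator (edge? i j) + indicator (edge? j i)
  adjacent≡edge+edge i j with <-cmp i j
  ... | tri< i<j _ j≮i = ≡-sym (trans (cong₂ _+_ (indicator-×-yes (i <? j) (adjacent? i j) i<j)
                                                 (indicator-×-no (j <? i) (adjacent? j i) j≮i))
                                     (+-identityʳ _))
  ... | tri> i≮j _ j<i = trans (indicator-adjacent-sym i j)
                               (≡-sym (cong₂ _+_ (indicator-×-no (i <? j) (adjacent? i j) i≮j)
                                                 (indicator-×-yes (j <? i) (adjacent? j i) j<i)))
  ... | tri≈ i≮i refl _ = trans (indicator-adjacent-irrefl i)
                                (≡-sym (cong₂ _+_ (indicator-×-no (i <? i) (adjacent? i i) i≮i)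
                                                  (indicator-×-no (i <? i) (adjacent? i i) i≮i)))

  weighted-handshake : ∀ (w : Fin n → ℕ) →
    ∑[ v < n ] (degree G v * w v) ≡ ∑[ i < n ] ∑[ j < n ] (indicator (edge? i j) * (w i + w j))
  weighted-handshake w = begin
    ∑[ v < n ] (degree G v * w v)
      ≡⟨ sum-cong-≗ (λ i → trans (cong (_* w i) (degree≡∑ i)) (*-distribʳ-sum (w i) (a i))) ⟩
    ∑[ i < n ] ∑[ j < n ] (a i j * w i)
      ≡⟨ sum-cong-≗ (λ i → sum-cong-≗ (λ j → trans (cong (_* w i) (adjacent≡edge+edge i j))
                                                    (*-distribʳ-+ (w i) (e i j) (e j i)))) ⟩
    ∑[ i < n ] ∑[ j < n ] (e i j * w i + e j i * w i)
      ≡⟨ ∑∑-distrib-+ (λ i j → e i j * w i) (λ i j → e j i * w i) ⟩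
    ∑[ i < n ] ∑[ j < n ] (e i j * w i) + ∑[ i < n ] ∑[ j < n ] (e j i * w i)
      ≡⟨ cong (∑[ i < n ] ∑[ j < n ] (e i j * w i) +_) (∑-comm (λ i j → e j i * w i)) ⟩
    ∑[ i < n ] ∑[ j < n ] (e i j * w i) + ∑[ i < n ] ∑[ j < n ] (e i j * w j)
      ≡⟨ ∑∑-distrib-+ (λ i j → e i j * w i) (λ i j → e i j * w j) ⟨
    ∑[ i < n ] ∑[ j < n ] (e i j * w i + e i j * w j)
      ≡⟨ sum-cong-≗ (λ i → sum-cong-≗ (λ j → *-distribˡ-+ (e i j) (w i) (w j))) ⟨
    ∑[ i < n ] ∑[ j < n ] (e i j * (w i + w j)) ∎
    where
    open ≡-Reasoning
    a e : Fin n → Fin n → ℕ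
    a i j = indicator (adjacent? i j)
    e i j = indicator (edge? i j)

  weighted-degree-sum-≤ : ∀ (w : Fin n → ℕ) {c} → (∀ i j → Adj G i j → w i + w j ≤ c) →
    ∑[ v < n ] (degree G v * w v) ≤ numEdges G * c
  weighted-degree-sum-≤ w {c} w≤c = begin
    ∑[ v < n ] (degree G v * w v)
      ≡⟨ weighted-handshake w ⟩
    ∑[ i < n ] ∑[ j < n ] (indicator (edge? i j) * (w i + w j))
      ≤⟨ ∑-mono-≤ (λ i → ∑-mono-≤ (λ j → indicator-*-mono (edge? i j) (w≤c i j ∘ proj₂))) ⟩
    ∑[ i < n ] ∑[ j < n ] (indicator (edge? i j) * c)
      ≡⟨ ∑∑-distribʳ-* (λ i j → indicator (edge? i j)) c ⟩
    (∑[ i < n ] ∑[ j < n ] indicator (edge? i j)) * c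
      ≡⟨ cong (_* c) numEdges≡∑∑ ⟨
    numEdges G * c ∎
    where open ≤-Reasoning

leafWeight : ℕ → ℕ
leafWeight d = 1 + indicator (d ≟ℕ 1)

2≤d*leafWeight : ∀ {d} → 1 ≤ d → 2 ≤ d * leafWeight d
2≤d*leafWeight {d} 1≤d = by-cases (d ≟ℕ 1)
  where
  by-cases : (d≟1 : Dec (d ≡ 1)) → 2 ≤ d * (1 + indicator d≟1)
  by-cases (yes refl) = ≤-refl
  by-cases (no d≢1) rewrite *-identityʳ d = ≤∧≢⇒< 1≤d (d≢1 ∘ ≡-sym)

leafWeight-+-≤3 : ∀ {d e} → ¬ (d ≡ 1 × e ≡ 1) → leafWeight d + leafWeight e ≤ 3
leafWeight-+-≤3 {d} {e} notBoth = by-cases (d ≟ℕ 1) (e ≟ℕ 1)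
  where
  by-cases : (d≟1 : Dec (d ≡ 1)) (e≟1 : Dec (e ≡ 1)) → (1 + indicator d≟1) + (1 + indicator e≟1) ≤ 3
  by-cases (yes d≡1) (yes e≡1) = ⊥-elim (notBoth (d≡1 , e≡1))
  by-cases (yes _)   (no _)    = ≤-refl
  by-cases (no _)    (yes _)   = ≤-refl
  by-cases (no _)    (no _)    = s≤s (s≤s z≤n)

ceil2n/3-≤ : ∀ n {m} → n * 2 ≤ m * 3 → ceil2n/3 n ≤ m
ceil2n/3-≤ n {m} 2n≤3m = s≤s⁻¹ (m<n*o⇒m/o<n (begin-strict
  2 * n + 2 ≡⟨ cong (_+ 2) (*-comm 2 n) ⟩
  n * 2 + 2 <⟨ +-monoʳ-< (n * 2) ≤-refl ⟩
  n * 2 + 3 ≤⟨ +-monoˡ-≤ 3 2n≤3m ⟩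
  m * 3 + 3 ≡⟨ +-comm (m * 3) 3 ⟩
  suc m * 3 ∎))
  where open ≤-Reasoning

lemma7 : (n : ℕ) (G : Graph n)
    → (∀ v → degree G v ≥ 1)
    → (∀ u v → Adj G u v → ¬ (degree G u ≡ 1 × degree G v ≡ 1))
    → numEdges G ≥ ceil2n/3 n
lemma7 n G δ≥1 noAdjacentLeaves = ceil2n/3-≤ n (begin
  n * 2                                              ≡⟨ ∑-const n 2 ⟨
  ∑[ v < n ] 2                                       ≤⟨ ∑-mono-≤ (λ v → 2≤d*leafWeight (δ≥1 v)) ⟩
  ∑[ v < n ] (degree G v * leafWeight (degree G v)) ≤⟨ weighted-degree-sum-≤ G (leafWeight ∘ degree G) leaves-apart ⟩
  numEdges G * 3                                     ∎)
  where
  open ≤-Reasoning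
  leaves-apart : ∀ u v → Adj G u v → leafWeight (degree G u) + leafWeight (degree G v) ≤ 3
  leaves-apart u v u~v = leafWeight-+-≤3 (noAdjacentLeaves u v u~v)
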